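{- Let $w$ be a finite or (right-)infinite rich word and let $u$ be any non-palindromic factor of $w$, with longest palindromic prefix $p$ and longest palindromic suffix $q$. Then $p \neq q$, $p$ is not a factor of $q$, and $q$ is not a factor of $p$.
   Context: For a finite word $w = x_1x_2\cdots x_m$ (letters $x_i$), $|w| = m$ is its length and $\tilde w = x_m\cdots x_2x_1$ its reversal; $w$ is a palindrome if $w = \tilde w$, and the empty word $\varepsilon$ is considered a palindrome. A finite word $z$ is a factor of a finite or infinite word $w$ if $w = uzv$ for some words $u,v$; it is a prefix if $u=\varepsilon$ and a suffix if $v = \varepsilon$. A finite word $w$ is rich if it has exactly $|w|+1$ distinct palindromic factors (including $\varepsilon$); an infinite word is rich if all of its finite factors are rich. -}

module Defs where

open import Level using (Level)
open import Data.Nat using (ℕ; suc; _+_; _≤_)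
open import Data.List using (List; []; _∷_; _++_; reverse; length; applyUpTo)
open import Data.List.Relation.Unary.All using (All)
open import Data.List.Relation.Unary.Unique.Propositional using (Unique)
open import Data.List.Membership.Propositional using (_∈_)
open import Data.Product using (Σ; ∃; ∃-syntax; _×_)
open import Relation.Binary.PropositionalEquality using (_≡_)

private variable
  a : Level

module _ {A : Set a} where

  Palindrome : List A → Set a
  Palindrome w = reverse w ≡ w

  Factor : List A → List A → Set a
  Factor z w = ∃[ u ] ∃[ v ] u ++ z ++ v ≡ w

  Prefix : List A → List A → Set a
  Prefix z w = ∃[ v ] z ++ v ≡ w

  Suffix : List A → List A → Set a
  Suffix z w = ∃[ u ] u ++ z ≡ w

  PalFactor : List A → List A → Set a
  PalFactor w z = Palindrome z × Factor z w

  -- w has exactly |w|+1 distinct palindromic factors (the empty word included):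
  -- there is a duplicate-free list enumerating precisely the palindromic
  -- factors of w, and its length is |w| + 1.
  Rich : List A → Set a
  Rich w = Σ (List (List A)) λ L →
             Unique L × All (PalFactor w) L
           × (∀ z → PalFactor w z → z ∈ L)
           × length L ≡ suc (length w)

  LongestPalPrefix : List A → List A → Set a
  LongestPalPrefix p u =
    Palindrome p × Prefix p u
    × (∀ p′ → Palindrome p′ → Prefix p′ u → length p′ ≤ length p)

  LongestPalSuffix : List A → List A → Set a
  LongestPalSuffix q u =
    Palindrome q × Suffix q u
    × (∀ q′ → Palindrome q′ → Suffix q′ u → length q′ ≤ length q)

  segment : (ℕ → A) → ℕ → ℕ → List A
  segment x i n = applyUpTo (λ k → x (i + k)) n

  InfFactor : List A → (ℕ → A) → Set a
  InfFactor z x = ∃[ i ] segment x i (length z) ≡ z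

  InfRich : (ℕ → A) → Set a
  InfRich x = ∀ z → InfFactor z x → Rich z

-- Appending a letter c to a word v creates at most one new palindromic
-- factor, the longest palindromic suffix of v c, since every shorter
-- palindromic suffix is a proper prefix of it.  Hence a word u has at most
-- |u| + 1 palindromic factors, and at most |u| when the longest palindromic
-- suffix of u already occurs in u minus its last letter.  This defect
-- propagates to every word containing u, which therefore is not rich.
-- When u is not a palindrome its longest palindromic prefix p is proper, so
-- q a factor of p yields the defect; p a factor of q is the mirror image.
--
-- Equality of letters is not assumed decidable, so the longest palindromic
-- suffix exists only in the double-negation monad, which suffices since the
-- goal is a negation.
module Submission where

open import Defs
open import Level using (Level)
open import Data.Nat using (ℕ; suc; _+_; _≤_; z≤n; s≤s)
open import Data.Nat.Properties
  using (≤-refl; ≤-trans; ≤-reflexive; m≤n+m; +-identityʳ; +-suc; +-comm; +-monoʳ-≤; +-cancelʳ-≤; 1+n≰n;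
         module ≤-Reasoning)
open import Data.List using (List; []; _∷_; _++_; _∷ʳ_; [_]; reverse; length)
open import Data.List.Properties
  using (++-assoc; ++-identityʳ; ++-conicalˡ; ++-conicalʳ; ∷-injective; ∷ʳ-injectiveˡ; length-++; length-++-sucʳ;
         reverse-++; reverse-involutive; length-reverse)
open import Data.List.Reverse using (reverseView; []; _∶_∶ʳ_)
open import Data.List.Membership.Propositional using (_∈_)
open import Data.List.Membership.Propositional.Properties using (∈-∃++)
open import Data.List.Relation.Binary.Subset.Propositional using (_⊆_)
open import Data.List.Relation.Unary.All as All using ()
open import Data.List.Relation.Unary.AllPairs using (_∷_)
open import Data.List.Relation.Unary.Any using (here; there)
open import Data.List.Relation.Unary.Unique.Propositional using (Unique)
open import Data.Product using (∃-syntax; _×_; _,_; proj₁; proj₂)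
open import Data.Sum using (_⊎_; inj₁; inj₂)
open import Data.Empty using (⊥-elim)
open import Effect.Monad using (RawMonad)
open import Function using (_∘_)
open import Relation.Nullary using (¬_; yes; no)
open import Relation.Nullary.Negation using (¬¬-Monad)
open import Relation.Nullary.Negation.Core using (DoubleNegation)
open import Relation.Nullary.Decidable.Core using (¬¬-excluded-middle)
open import Relation.Binary.PropositionalEquality
  using (_≡_; _≢_; refl; sym; trans; cong; cong₂; subst; subst₂; module ≡-Reasoning)

unique-⊆⇒length≤ : ∀ {b} {B : Set b} {xs ys : List B} → Unique xs → xs ⊆ ys → length xs ≤ length ys
unique-⊆⇒length≤ {xs = []} _ _ = z≤n
unique-⊆⇒length≤ {xs = x ∷ xs} (x∉xs ∷ uniq) xs⊆ys with ∈-∃++ (xs⊆ys (here refl))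
... | ys₁ , ys₂ , refl =
  ≤-trans (s≤s (unique-⊆⇒length≤ uniq (λ z∈xs → delete ys₁ (xs⊆ys (there z∈xs)) (All.lookup x∉xs z∈xs))))
          (≤-reflexive (sym (length-++-sucʳ ys₁ x ys₂)))
  where
  delete : ∀ {z} ys₁ {ys₂} → z ∈ ys₁ ++ x ∷ ys₂ → x ≢ z → z ∈ ys₁ ++ ys₂
  delete []        (here x≡z)  x≢z = ⊥-elim (x≢z (sym x≡z))
  delete []        (there z∈)  _   = z∈
  delete (_ ∷ ys₁) (here z≡y)  _   = here z≡y
  delete (_ ∷ ys₁) (there z∈)  x≢z = there (delete ys₁ z∈ x≢z)

module _ {a : Level} {A : Set a} where

  open RawMonad (¬¬-Monad {a})

  private
    ¬¬_ : Set a → Set a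
    ¬¬_ = DoubleNegation

  -- Equality on A need not be decidable, so "v has at most n palindromic
  -- factors" is witnessed by a list of at most n words containing them all.
  PalCover : List A → ℕ → Set a
  PalCover v n = ∃[ M ] length M ≤ n × (∀ z → PalFactor v z → z ∈ M)

  factor-refl : ∀ (w : List A) → Factor w w
  factor-refl w = [] , [] , ++-identityʳ w

  factor-prefix : ∀ {z p v : List A} → Factor z p → Prefix p v → Factor z v
  factor-prefix {z} (u₁ , u₂ , refl) (t , refl) = u₁ , u₂ ++ t , (begin
    u₁ ++ z ++ u₂ ++ t     ≡⟨ cong (u₁ ++_) (sym (++-assoc z u₂ t)) ⟩
    u₁ ++ (z ++ u₂) ++ t   ≡⟨ sym (++-assoc u₁ (z ++ u₂) t) ⟩
    (u₁ ++ z ++ u₂) ++ t   ∎)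
    where open ≡-Reasoning

  factor-∷ʳ⁻ : ∀ u₁ (z u₂ : List A) {b v c} → u₁ ++ z ++ (u₂ ∷ʳ b) ≡ v ∷ʳ c → Factor z v
  factor-∷ʳ⁻ u₁ z u₂ {b} {v} e = u₁ , u₂ , ∷ʳ-injectiveˡ (u₁ ++ z ++ u₂) v (begin
    (u₁ ++ z ++ u₂) ∷ʳ b   ≡⟨ ++-assoc u₁ (z ++ u₂) [ b ] ⟩
    u₁ ++ (z ++ u₂) ∷ʳ b   ≡⟨ cong (u₁ ++_) (++-assoc z u₂ [ b ]) ⟩
    u₁ ++ z ++ (u₂ ∷ʳ b)   ≡⟨ e ⟩
    v ∷ʳ _                 ∎)
    where open ≡-Reasoning

  factor-∷ʳ : ∀ {z v : List A} {c} → Factor z (v ∷ʳ c) → Factor z v ⊎ Suffix z (v ∷ʳ c)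
  factor-∷ʳ (u₁ , u₂ , e) with reverseView u₂
  ... | []            = inj₂ (u₁ , trans (cong (u₁ ++_) (sym (++-identityʳ _))) e)
  ... | u₂′ ∶ _ ∶ʳ b  = inj₁ (factor-∷ʳ⁻ u₁ _ u₂′ e)

  factor-reverse : ∀ {z w : List A} → Factor z w → Factor (reverse z) (reverse w)
  factor-reverse {z} (u₁ , u₂ , refl) = reverse u₂ , reverse u₁ , (begin
    reverse u₂ ++ reverse z ++ reverse u₁   ≡⟨ sym (++-assoc (reverse u₂) (reverse z) (reverse u₁)) ⟩
    (reverse u₂ ++ reverse z) ++ reverse u₁ ≡⟨ cong (_++ reverse u₁) (sym (reverse-++ z u₂)) ⟩
    reverse (z ++ u₂) ++ reverse u₁         ≡⟨ sym (reverse-++ u₁ (z ++ u₂)) ⟩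
    reverse (u₁ ++ z ++ u₂)                 ∎)
    where open ≡-Reasoning

  prefix-reverse : ∀ {z w : List A} → Prefix z w → Suffix (reverse z) (reverse w)
  prefix-reverse {z} (t , refl) = reverse t , sym (reverse-++ z t)

  suffix-reverse : ∀ {z w : List A} → Suffix z w → Prefix (reverse z) (reverse w)
  suffix-reverse {z} (s , refl) = reverse s , sym (reverse-++ s z)

  suffix-length : ∀ {z w : List A} → Suffix z w → length z ≤ length w
  suffix-length {z} (s , refl) = ≤-trans (m≤n+m (length z) (length s)) (≤-reflexive (sym (length-++ s)))

  suffix-∷ : ∀ {z v : List A} {b} → Suffix z (b ∷ v) → z ≡ b ∷ v ⊎ Suffix z v
  suffix-∷ ([]    , e) = inj₁ e
  suffix-∷ (_ ∷ s , e) = inj₂ (s , proj₂ (∷-injective e))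

  suffix-of-suffix : ∀ {z r w : List A} → Suffix z w → Suffix r w → length z ≤ length r → Suffix z r
  suffix-of-suffix {z} {r} (s₁ , e₁) (s₂ , e₂) |z|≤|r| = split s₁ s₂ (trans e₁ (sym e₂)) |s₂|≤|s₁|
    where
    |s₂|≤|s₁| : length s₂ ≤ length s₁
    |s₂|≤|s₁| = +-cancelʳ-≤ (length z) (length s₂) (length s₁) (begin
      length s₂ + length z  ≤⟨ +-monoʳ-≤ (length s₂) |z|≤|r| ⟩
      length s₂ + length r  ≡⟨ sym (length-++ s₂) ⟩
      length (s₂ ++ r)      ≡⟨ cong length (trans e₂ (sym e₁)) ⟩
      length (s₁ ++ z)      ≡⟨ length-++ s₁ ⟩
      length s₁ + length z  ∎)
      where open ≤-Reasoning
    split : ∀ s₁ s₂ → s₁ ++ z ≡ s₂ ++ r → length s₂ ≤ length s₁ → Suffix z r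
    split s₁      []       e _         = s₁ , e
    split (_ ∷ s₁) (_ ∷ s₂) e (s≤s le) = split s₁ s₂ (proj₂ (∷-injective e)) le

  palindrome-suffix⇒prefix : ∀ {z r : List A} → Palindrome z → Palindrome r → Suffix z r → Prefix z r
  palindrome-suffix⇒prefix pz pr sz = subst₂ Prefix pz pr (suffix-reverse sz)

  palFactor-reverse⁻ : ∀ {z v : List A} → PalFactor (reverse v) z → PalFactor v z
  palFactor-reverse⁻ {v = v} (pz , fz) =
    pz , subst₂ Factor pz (reverse-involutive v) (factor-reverse fz)

  longestPalPrefix⇒longestPalSuffix-reverse : ∀ {p u : List A} →
    LongestPalPrefix p u → LongestPalSuffix p (reverse u)
  longestPalPrefix⇒longestPalSuffix-reverse {u = u} (pp , pre , max) =
    pp , subst (λ p → Suffix p (reverse u)) pp (prefix-reverse pre) ,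
    λ z pz sz → max z pz (subst₂ Prefix pz (reverse-involutive u) (suffix-reverse sz))

  longestPalSuffix-∷ : ∀ {r v : List A} {b} → ¬ Palindrome (b ∷ v) →
    LongestPalSuffix r v → LongestPalSuffix r (b ∷ v)
  longestPalSuffix-∷ {r} {v} {b} ¬pal (pr , (s , e) , max) = pr , (b ∷ s , cong (b ∷_) e) , max′
    where
    max′ : ∀ z → Palindrome z → Suffix z (b ∷ v) → length z ≤ length r
    max′ z pz sz with suffix-∷ sz
    ... | inj₁ refl = ⊥-elim (¬pal pz)
    ... | inj₂ sz′  = max z pz sz′

  longestPalSuffix : ∀ (v : List A) → ¬¬ (∃[ r ] LongestPalSuffix r v)
  longestPalSuffix [] = return ([] , refl , ([] , refl) , λ _ _ → suffix-length)
  longestPalSuffix (b ∷ v) = do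
    no ¬pal ← ¬¬-excluded-middle
      where yes pal → return (b ∷ v , pal , ([] , refl) , λ _ _ → suffix-length)
    (r , lps) ← longestPalSuffix v
    return (r , longestPalSuffix-∷ ¬pal lps)

  prefix-of-suffix-∷ʳ : ∀ {z r v : List A} {c} → Prefix z r → Suffix r (v ∷ʳ c) → z ≡ r ⊎ Factor z v
  prefix-of-suffix-∷ʳ {z} (t , z++t≡r) (s , s++r≡vc) with reverseView t
  ... | []           = inj₁ (trans (sym (++-identityʳ z)) z++t≡r)
  ... | t′ ∶ _ ∶ʳ b  = inj₂ (factor-∷ʳ⁻ s z t′ (trans (cong (s ++_) z++t≡r) s++r≡vc))

  palFactor-∷ʳ : ∀ {r z v : List A} {c} → LongestPalSuffix r (v ∷ʳ c) →
    PalFactor (v ∷ʳ c) z → z ≡ r ⊎ Factor z v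
  palFactor-∷ʳ (pr , sr , max) (pz , fz) with factor-∷ʳ fz
  ... | inj₁ fz′ = inj₂ fz′
  ... | inj₂ sz  = prefix-of-suffix-∷ʳ
    (palindrome-suffix⇒prefix pz pr (suffix-of-suffix sz sr (max _ pz sz))) sr

  palCover-[] : PalCover [] 1
  palCover-[] = [ [] ] , ≤-refl ,
    λ { z (_ , u₁ , u₂ , e) → here (++-conicalˡ z u₂ (++-conicalʳ u₁ (z ++ u₂) e)) }

  palCover-∷ʳ : ∀ {v n} c → PalCover v n → ¬¬ PalCover (v ∷ʳ c) (suc n)
  palCover-∷ʳ {v} c (M , |M|≤n , cover) = do
    (r , lps) ← longestPalSuffix (v ∷ʳ c)
    return (r ∷ M , s≤s |M|≤n , cover′ lps)
    where
    cover′ : ∀ {r} → LongestPalSuffix r (v ∷ʳ c) → ∀ z → PalFactor (v ∷ʳ c) z → z ∈ r ∷ M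
    cover′ lps z pz with palFactor-∷ʳ lps pz
    ... | inj₁ z≡r = here z≡r
    ... | inj₂ fz  = there (cover z (proj₁ pz , fz))

  palCover-reverse : ∀ {v n} → PalCover v n → PalCover (reverse v) n
  palCover-reverse (M , |M|≤n , cover) = M , |M|≤n , λ z → cover z ∘ palFactor-reverse⁻

  palCover-++ʳ : ∀ {v n} y → PalCover v n → ¬¬ PalCover (v ++ y) (n + length y)
  palCover-++ʳ {v} {n} [] cov =
    return (subst₂ PalCover (sym (++-identityʳ v)) (sym (+-identityʳ n)) cov)
  palCover-++ʳ {v} {n} (c ∷ y) cov = do
    cov′ ← palCover-∷ʳ c cov
    cov″ ← palCover-++ʳ y cov′
    return (subst₂ PalCover (++-assoc v [ c ] y) (sym (+-suc n (length y))) cov″)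

  palCover-++ˡ : ∀ {v n} x → PalCover v n → ¬¬ PalCover (x ++ v) (length x + n)
  palCover-++ˡ {v} {n} x cov = do
    cov′ ← palCover-++ʳ (reverse x) (palCover-reverse cov)
    return (subst₂ PalCover reverse-twice |x|+n (palCover-reverse cov′))
    where
    reverse-twice : reverse (reverse v ++ reverse x) ≡ x ++ v
    reverse-twice = begin
      reverse (reverse v ++ reverse x)           ≡⟨ reverse-++ (reverse v) (reverse x) ⟩
      reverse (reverse x) ++ reverse (reverse v) ≡⟨ cong₂ _++_ (reverse-involutive x) (reverse-involutive v) ⟩
      x ++ v                                     ∎
      where open ≡-Reasoning
    |x|+n : n + length (reverse x) ≡ length x + n
    |x|+n = trans (cong (n +_) (length-reverse x)) (+-comm n (length x))

  palCover-length : ∀ v → ¬¬ PalCover v (suc (length v))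
  palCover-length v = palCover-++ʳ v palCover-[]

  palCover-factor : ∀ {u w} → Factor u w → PalCover u (length u) → ¬¬ PalCover w (length w)
  palCover-factor {u} (x , y , refl) cov = do
    cov′ ← palCover-++ʳ y cov
    cov″ ← palCover-++ˡ x cov′
    return (subst (PalCover _) |xuy| cov″)
    where
    |xuy| : length x + (length u + length y) ≡ length (x ++ u ++ y)
    |xuy| = sym (trans (length-++ x) (cong (length x +_) (length-++ u)))

  rich⇒¬palCover : ∀ {w} → Rich w → ¬ PalCover w (length w)
  rich⇒¬palCover (L , uniq , pals , _ , |L|≡1+|w|) (M , |M|≤|w| , cover) =
    1+n≰n (≤-trans (≤-reflexive (sym |L|≡1+|w|))
                   (≤-trans (unique-⊆⇒length≤ uniq (λ {z} z∈L → cover z (All.lookup pals z∈L))) |M|≤|w|))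

  palCover-∷ʳ-repeated : ∀ {q u v : List A} {c} → LongestPalSuffix q u → v ∷ʳ c ≡ u →
    Factor q v → ¬¬ PalCover u (length u)
  palCover-∷ʳ-repeated {v = v} {c} lps refl fq = do
    (M , |M|≤1+|v| , cover) ← palCover-length v
    let |vc| = trans (length-++ v) (+-comm (length v) 1)
    return (M , ≤-trans |M|≤1+|v| (≤-reflexive (sym |vc|)) , cover′ cover)
    where
    cover′ : ∀ {M} → (∀ z → PalFactor v z → z ∈ M) → ∀ z → PalFactor (v ∷ʳ c) z → z ∈ M
    cover′ cover z pz with palFactor-∷ʳ lps pz
    ... | inj₁ refl = cover z (proj₁ pz , fq)
    ... | inj₂ fz   = cover z (proj₁ pz , fz)

  palCover-lps⊑prefix : ∀ {u p q : List A} → ¬ Palindrome u → Palindrome p → Prefix p u →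
    LongestPalSuffix q u → Factor q p → ¬¬ PalCover u (length u)
  palCover-lps⊑prefix {p = p} ¬pu pp (t , p++t≡u) lps fqp with reverseView t
  ... | []          = ⊥-elim (¬pu (subst Palindrome (trans (sym (++-identityʳ p)) p++t≡u) pp))
  ... | t′ ∶ _ ∶ʳ c = palCover-∷ʳ-repeated lps (trans (++-assoc p t′ [ c ]) p++t≡u)
                        (factor-prefix fqp (t′ , refl))

  palCover-lpp⊑suffix : ∀ {u p q : List A} → ¬ Palindrome u → LongestPalPrefix p u →
    Palindrome q → Suffix q u → Factor p q → ¬¬ PalCover u (length u)
  palCover-lpp⊑suffix {u} ¬pu lpp pq sq fpq = do
    cov ← palCover-lps⊑prefix ¬pũ pq (subst (λ q → Prefix q (reverse u)) pq (suffix-reverse sq))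
            (longestPalPrefix⇒longestPalSuffix-reverse lpp) fpq
    return (subst₂ PalCover (reverse-involutive u) (length-reverse u) (palCover-reverse cov))
    where
    ¬pũ : ¬ Palindrome (reverse u)
    ¬pũ pũ = ¬pu (trans (sym pũ) (reverse-involutive u))

  rich-factor-¬palCover : ∀ {u w : List A} → Rich w → Factor u w → ¬ ¬¬ PalCover u (length u)
  rich-factor-¬palCover rw fu ¬¬cov = (¬¬cov >>= palCover-factor fu) (rich⇒¬palCover rw)

lemma3p1 : ∀ {a : Level} {A : Set a} →
    (∀ (w u p q : List A) → Rich w → Factor u w → ¬ Palindrome u →
    LongestPalPrefix p u → LongestPalSuffix q u →
    (p ≢ q) × (¬ Factor p q) × (¬ Factor q p))
    × (∀ (x : ℕ → A) (u p q : List A) → InfRich x → InfFactor u x → ¬ Palindrome u →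
    LongestPalPrefix p u → LongestPalSuffix q u →
    (p ≢ q) × (¬ Factor p q) × (¬ Factor q p))
lemma3p1 {A = A} = finite , λ x u p q rx fu → finite u u p q (rx u fu) (factor-refl u)
  where
  finite : ∀ (w u p q : List A) → Rich w → Factor u w → ¬ Palindrome u →
    LongestPalPrefix p u → LongestPalSuffix q u →
    (p ≢ q) × (¬ Factor p q) × (¬ Factor q p)
  finite _ u p q rw fu ¬pu lpp@(pp , pre , _) lps@(pq , suf , _) = p≢q , ¬p⊑q , ¬q⊑p
    where
    ¬q⊑p : ¬ Factor q p
    ¬q⊑p q⊑p = rich-factor-¬palCover rw fu (palCover-lps⊑prefix ¬pu pp pre lps q⊑p)
    ¬p⊑q : ¬ Factor p q
    ¬p⊑q p⊑q = rich-factor-¬palCover rw fu (palCover-lpp⊑suffix ¬pu lpp pq suf p⊑q)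
    p≢q : p ≢ q
    p≢q refl = ¬p⊑q (factor-refl p)
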